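{- Let $E$ be an extension field of a finite field $F$, where $|F|\ge4$. Let $a_1,a_2$ be distinct elements of $F\setminus\{0,1\}$, and let $k=(|E|-1)/(|F|-1)$. Then the cyclotomic map $\theta$ of index $k$ over $E$ with multipliers $[a_1,a_2,\dots,a_2]$ (where $a_2$ occurs $k-1$ times) is an orthomorphism over $E$ of least index $k$, i.e. $\theta\in\mathscr{D}_k(|E|)$.
   Context: For a finite field $\mathbb{F}_q$: an orthomorphism is a permutation $\theta$ of $\mathbb{F}_q$ such that $x\mapsto\theta(x)-x$ is also a permutation. For $k\mid(q-1)$, fix a generator $g$ of $\mathbb{F}_q^*$ and let $C_{k,i}=\{g^j: j\equiv i\pmod k\}$, $0\le i<k$ (cyclotomy classes of index $k$; $C_{k,0}$ is the subgroup of index $k$). A cyclotomic map of index $k$ with multipliers $[a_0,\dots,a_{k-1}]$ is $\theta(0)=0$, $\theta(x)=a_ix$ for $x\in C_{k,i}$. $\mathscr{C}_k(q)$ is the set of orthomorphisms that are cyclotomic maps of index $k$, and $\mathscr{D}_k(q)=\mathscr{C}_k(q)\setminus\bigcup_{\ell<k,\ \ell\mid(q-1)}\mathscr{C}_\ell(q)$ (orthomorphisms of least index $k$). -}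

module Defs where

open import Level using (0ℓ)
open import Data.Nat as ℕ using (ℕ; _∸_; _<_; _%_; NonZero)
open import Data.Nat.Divisibility using (_∣_)
open import Data.Fin as Fin using (Fin; toℕ)
open import Data.Product using (Σ; ∃; _×_; _,_)
open import Relation.Nullary using (¬_)
open import Relation.Binary.PropositionalEquality using (_≡_; _≢_)
open import Algebra.Structures using (IsCommutativeRing)
open import Function.Bundles using (_↔_)
open import Function.Definitions using (Bijective)

record FiniteField : Set₁ where
  infixl 6 _+_
  infixl 7 _*_
  field
    Carrier : Set
    _+_ _*_ : Carrier → Carrier → Carrier
    -_      : Carrier → Carrier
    0# 1#   : Carrier
    isCommutativeRing : IsCommutativeRing _≡_ _+_ _*_ -_ 0# 1#
    0≢1     : 0# ≢ 1#
    inverse : ∀ x → x ≢ 0# → ∃ λ y → x * y ≡ 1#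
    size    : ℕ
    enum    : Carrier ↔ Fin size

  _-_ : Carrier → Carrier → Carrier
  x - y = x + (- y)

  _^_ : Carrier → ℕ → Carrier
  x ^ ℕ.zero  = 1#
  x ^ ℕ.suc n = x * (x ^ n)

record Extension (F E : FiniteField) : Set where
  private
    module F = FiniteField F
    module E = FiniteField E
  field
    ι      : F.Carrier → E.Carrier
    ι-+    : ∀ x y → ι (x F.+ y) ≡ ι x E.+ ι y
    ι-*    : ∀ x y → ι (x F.* y) ≡ ι x E.* ι y
    ι-1    : ι F.1# ≡ E.1#

module _ (E : FiniteField) where
  open FiniteField E

  IsGenerator : Carrier → Set
  IsGenerator g = g ≢ 0# × (∀ x → x ≢ 0# → ∃ λ j → g ^ j ≡ x)

  InClass : (g : Carrier) (k : ℕ) .{{_ : NonZero k}} → Fin k → Carrier → Set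
  InClass g k i x = ∃ λ j → (j % k ≡ toℕ i) × (g ^ j ≡ x)

  IsCyclotomicMap : (g : Carrier) (k : ℕ) .{{_ : NonZero k}} →
                    (Fin k → Carrier) → (Carrier → Carrier) → Set
  IsCyclotomicMap g k a θ =
    (θ 0# ≡ 0#) × (∀ i x → InClass g k i x → θ x ≡ a i * x)

  IsOrthomorphism : (Carrier → Carrier) → Set
  IsOrthomorphism θ = Bijective _≡_ _≡_ θ × Bijective _≡_ _≡_ (λ x → θ x - x)

  InC : (g : Carrier) (k : ℕ) .{{_ : NonZero k}} → (Carrier → Carrier) → Set
  InC g k θ = IsOrthomorphism θ × ∃ λ (a : Fin k → Carrier) → IsCyclotomicMap g k a θ

  InD : (g : Carrier) (k : ℕ) .{{_ : NonZero k}} → (Carrier → Carrier) → Set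
  InD g k θ = InC g k θ ×
    (∀ ℓ .{{_ : NonZero ℓ}} → ℓ < k → ℓ ∣ (size ∸ 1) → ¬ InC g ℓ θ)

firstThenRest : {A : Set} (k : ℕ) → A → A → Fin k → A
firstThenRest k b₁ b₂ Fin.zero    = b₁
firstThenRest k b₁ b₂ (Fin.suc _) = b₂

{-# OPTIONS --safe #-}
-- Since k = (|E| - 1)/(|F| - 1), every ι c with c ∈ F* satisfies (ι c)^(|F|-1) = 1 and is therefore
-- a k-th power of the generator g; multiplying by it preserves each cyclotomy class C_{k,i}.  Hence a
-- cyclotomic map whose multipliers all lie in ι(F*) is a bijection.  Both θ and θ - id are such maps,
-- the latter with multipliers ι a - 1 = ι (a - 1) ≠ 0.  If θ were also cyclotomic of an index
-- 0 < ℓ < k, then 1 and g^ℓ would share a multiplier of index ℓ, while θ multiplies them by a₁ and a₂.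
module Submission where

open import Defs
open import Level using (0ℓ)
open import Data.Nat using (ℕ; zero; suc; _∸_; _≤_; _<_; NonZero)
import Data.Nat as ℕ
import Data.Nat.Properties as ℕ
open import Data.Nat.DivMod using (_%_; _/_; _mod_; m≡m%n+[m/n]*n; [m+kn]%n≡m%n; m%n<n; n%n≡0; m<n⇒m%n≡m)
open import Data.Nat.Divisibility using (_∣_; *-cancelʳ-∣; m%n≡0⇒n∣m)
open import Data.Fin as Fin using (Fin; toℕ; fromℕ<; punchIn)
open import Data.Fin.Properties using (¬Fin0; toℕ-fromℕ<; punchInᵢ≢i; punchIn-injective; pigeonhole; <⇒≢)
import Data.Fin.Properties as Finₚ
open import Data.Fin.Permutation using (Permutation)
open import Data.Product using (∃; ∃₂; _×_; _,_; proj₁; proj₂)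
open import Data.Empty using (⊥; ⊥-elim)
open import Function using (_∘_)
open import Function.Bundles using (Inverse; Injection; _↔_; mk↔ₛ′)
open import Function.Properties.Inverse using (↔⇒↣)
open import Function.Construct.Composition using (_↔-∘_)
open import Function.Construct.Symmetry using (↔-sym)
open import Function.Definitions using (Bijective; Injective)
open import Function.Consequences.Propositional using (strictlySurjective⇒surjective)
open import Relation.Nullary using (¬_; yes; no)
open import Relation.Nullary.Decidable using (map′)
open import Relation.Binary.Definitions using (DecidableEquality)
open import Relation.Binary.PropositionalEquality
open import Algebra.Bundles using (CommutativeRing)
open import Algebra.Structures using (IsCommutativeRing)
import Algebra.Properties.Ring as RingProperties

module FiniteFieldProperties (K : FiniteField) where
  open FiniteField K
  open IsCommutativeRing isCommutativeRing
    using (*-assoc; *-comm; *-identityˡ; *-identityʳ; zeroʳ; distribʳ; -‿inverseʳ)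
  open ≡-Reasoning

  commutativeRing : CommutativeRing 0ℓ 0ℓ
  commutativeRing = record
    { Carrier = Carrier ; _≈_ = _≡_ ; _+_ = _+_ ; _*_ = _*_ ; -_ = -_ ; 0# = 0# ; 1# = 1#
    ; isCommutativeRing = isCommutativeRing }

  open RingProperties (CommutativeRing.ring commutativeRing) using (-‿distribˡ-*)

  open import Algebra.Properties.CommutativeMonoid.Sum (CommutativeRing.*-commutativeMonoid commutativeRing)
    using () renaming (sum to product; sum-permute to product-permute; sum-remove to product-remove;
                       ∑-distrib-+ to product-distrib; sum-cong-≗ to product-cong)

  infix 4 _≟_
  _≟_ : DecidableEquality Carrier
  x ≟ y = map′ (Injection.injective (↔⇒↣ enum)) (cong (Inverse.to enum)) (Inverse.to enum x Finₚ.≟ Inverse.to enum y)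

  inverse-cancelˡ : ∀ {x y} → x * y ≡ 1# → ∀ z → y * (x * z) ≡ z
  inverse-cancelˡ {x} {y} xy≡1 z = begin
    y * (x * z)  ≡⟨ *-assoc y x z ⟨
    (y * x) * z  ≡⟨ cong (_* z) (trans (*-comm y x) xy≡1) ⟩
    1# * z       ≡⟨ *-identityˡ z ⟩
    z            ∎

  inverse-cancelʳ : ∀ {x y} → x * y ≡ 1# → ∀ z → x * (y * z) ≡ z
  inverse-cancelʳ {x} {y} xy≡1 = inverse-cancelˡ (trans (*-comm y x) xy≡1)

  inverse-≢0 : ∀ {x y} → x * y ≡ 1# → y ≢ 0#
  inverse-≢0 {x} xy≡1 refl = 0≢1 (trans (sym (zeroʳ x)) xy≡1)

  *-cancelˡ : ∀ {x y z} → x ≢ 0# → x * y ≡ x * z → y ≡ z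
  *-cancelˡ {x} {y} {z} x≢0 xy≡xz with inverse x x≢0
  ... | x⁻¹ , xx⁻¹≡1 = begin
    y              ≡⟨ inverse-cancelˡ xx⁻¹≡1 y ⟨
    x⁻¹ * (x * y)  ≡⟨ cong (x⁻¹ *_) xy≡xz ⟩
    x⁻¹ * (x * z)  ≡⟨ inverse-cancelˡ xx⁻¹≡1 z ⟩
    z              ∎

  *-cancelʳ : ∀ {x y z} → x ≢ 0# → y * x ≡ z * x → y ≡ z
  *-cancelʳ {x} {y} {z} x≢0 yx≡zx = *-cancelˡ x≢0 (trans (*-comm x y) (trans yx≡zx (*-comm z x)))

  *-≢0 : ∀ {x y} → x ≢ 0# → y ≢ 0# → x * y ≢ 0#
  *-≢0 {x} x≢0 y≢0 xy≡0 = y≢0 (*-cancelˡ x≢0 (trans xy≡0 (sym (zeroʳ x))))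

  ^-+ : ∀ x m n → x ^ (m ℕ.+ n) ≡ x ^ m * x ^ n
  ^-+ x zero    n = sym (*-identityˡ (x ^ n))
  ^-+ x (suc m) n = trans (cong (x *_) (^-+ x m n)) (sym (*-assoc x (x ^ m) (x ^ n)))

  ^-* : ∀ x m n → x ^ (m ℕ.* n) ≡ (x ^ m) ^ n
  ^-* x m zero    = cong (x ^_) (ℕ.*-zeroʳ m)
  ^-* x m (suc n) = begin
    x ^ (m ℕ.* suc n)      ≡⟨ cong (x ^_) (ℕ.*-suc m n) ⟩
    x ^ (m ℕ.+ m ℕ.* n)    ≡⟨ ^-+ x m (m ℕ.* n) ⟩
    x ^ m * x ^ (m ℕ.* n)  ≡⟨ cong (x ^ m *_) (^-* x m n) ⟩
    x ^ m * (x ^ m) ^ n    ∎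

  1^ : ∀ n → 1# ^ n ≡ 1#
  1^ zero    = refl
  1^ (suc n) = trans (cong (1# *_) (1^ n)) (*-identityˡ 1#)

  ^-≢0 : ∀ {x} → x ≢ 0# → ∀ n → x ^ n ≢ 0#
  ^-≢0 x≢0 zero    = 0≢1 ∘ sym
  ^-≢0 x≢0 (suc n) = *-≢0 x≢0 (^-≢0 x≢0 n)

  ^-% : ∀ {x n} .{{_ : NonZero n}} → x ^ n ≡ 1# → ∀ m → x ^ m ≡ x ^ (m % n)
  ^-% {x} {n} xⁿ≡1 m = begin
    x ^ m                              ≡⟨ cong (x ^_) (m≡m%n+[m/n]*n m n) ⟩
    x ^ (m % n ℕ.+ (m / n) ℕ.* n)      ≡⟨ ^-+ x (m % n) ((m / n) ℕ.* n) ⟩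
    x ^ (m % n) * x ^ ((m / n) ℕ.* n)  ≡⟨ cong (λ e → x ^ (m % n) * x ^ e) (ℕ.*-comm (m / n) n) ⟩
    x ^ (m % n) * x ^ (n ℕ.* (m / n))  ≡⟨ cong (x ^ (m % n) *_) (^-* x n (m / n)) ⟩
    x ^ (m % n) * (x ^ n) ^ (m / n)    ≡⟨ cong (λ y → x ^ (m % n) * y ^ (m / n)) xⁿ≡1 ⟩
    x ^ (m % n) * 1# ^ (m / n)         ≡⟨ cong (x ^ (m % n) *_) (1^ (m / n)) ⟩
    x ^ (m % n) * 1#                   ≡⟨ *-identityʳ (x ^ (m % n)) ⟩
    x ^ (m % n)                        ∎

  ^-mod : ∀ {x n} .{{_ : NonZero n}} → x ^ n ≡ 1# → ∀ a b → a mod n ≡ b mod n → x ^ a ≡ x ^ b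
  ^-mod {x} {n} xⁿ≡1 a b a≡b = begin
    x ^ a        ≡⟨ ^-% xⁿ≡1 a ⟩
    x ^ (a % n)  ≡⟨ cong (x ^_) a%n≡b%n ⟩
    x ^ (b % n)  ≡⟨ ^-% xⁿ≡1 b ⟨
    x ^ b        ∎
    where
    a%n≡b%n : a % n ≡ b % n
    a%n≡b%n = trans (sym (toℕ-fromℕ< (m%n<n a n))) (trans (cong toℕ a≡b) (toℕ-fromℕ< (m%n<n b n)))

  -- Stated for an arbitrary enumeration, so that |K| = s + 1 can be exposed by pattern matching.

  module Enumeration {s : ℕ} (e : Carrier ↔ Fin (suc s)) where
    open Inverse e using (to; from; strictlyInverseˡ)

    nonzeroElem : Fin s → Carrier
    nonzeroElem i = from (punchIn (to 0#) i)

    nonzeroElem-≢0 : ∀ i → nonzeroElem i ≢ 0#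
    nonzeroElem-≢0 i eq = punchInᵢ≢i (to 0#) i (trans (sym (strictlyInverseˡ _)) (cong to eq))

    nonzeroElem-injective : ∀ {i j} → nonzeroElem i ≡ nonzeroElem j → i ≡ j
    nonzeroElem-injective {i} {j} eq =
      punchIn-injective (to 0#) i j (Injection.injective (↔⇒↣ (↔-sym e)) eq)

  instance
    nonZero-size∸1 : NonZero (size ∸ 1)
    nonZero-size∸1 = nonZero enum
      where
      nonZero : ∀ {n} → Carrier ↔ Fin n → NonZero (n ∸ 1)
      nonZero {zero}        e = ⊥-elim (¬Fin0 (Inverse.to e 0#))
      nonZero {suc zero}    e with Inverse.to e 0# | Inverse.to e 1# | Injection.injective (↔⇒↣ e) {0#} {1#}
      ... | Fin.zero | Fin.zero | inj = ⊥-elim (0≢1 (inj refl))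
      nonZero {suc (suc n)} e = _

  -- Fermat: multiplying by c permutes K, so the product P of all nonzero elements (0 counted as 1)
  -- satisfies P = c^(|K|-1) P.

  private
    ifZero : Carrier → Carrier → Carrier → Carrier
    ifZero x a b with x ≟ 0#
    ... | yes _ = a
    ... | no  _ = b

    ifZero-0 : ∀ a b → ifZero 0# a b ≡ a
    ifZero-0 a b with 0# ≟ 0#
    ... | yes _   = refl
    ... | no  0≢0 = ⊥-elim (0≢0 refl)

    ifZero-≢0 : ∀ {x} a b → x ≢ 0# → ifZero x a b ≡ b
    ifZero-≢0 {x} a b x≢0 with x ≟ 0#
    ... | yes x≡0 = ⊥-elim (x≢0 x≡0)
    ... | no  _   = refl

    nonzeroPart : Carrier → Carrier
    nonzeroPart x = ifZero x 1# x

    nonzeroPart-≢0 : ∀ x → nonzeroPart x ≢ 0#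
    nonzeroPart-≢0 x with x ≟ 0#
    ... | yes _   = 0≢1 ∘ sym
    ... | no  x≢0 = x≢0

    nonzeroPart-* : ∀ {c} → c ≢ 0# → ∀ x → nonzeroPart (c * x) ≡ ifZero x 1# c * nonzeroPart x
    nonzeroPart-* {c} c≢0 x with x ≟ 0#
    ... | yes refl = begin
      nonzeroPart (c * 0#)  ≡⟨ cong nonzeroPart (zeroʳ c) ⟩
      nonzeroPart 0#        ≡⟨ ifZero-0 1# 0# ⟩
      1#                    ≡⟨ *-identityˡ 1# ⟨
      1# * 1#               ∎
    ... | no x≢0 = ifZero-≢0 1# (c * x) (*-≢0 c≢0 x≢0)

    product-≢0 : ∀ {n} (f : Fin n → Carrier) → (∀ i → f i ≢ 0#) → product f ≢ 0#
    product-≢0 {zero}  f f≢0 = 0≢1 ∘ sym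
    product-≢0 {suc n} f f≢0 = *-≢0 (f≢0 Fin.zero) (product-≢0 (f ∘ Fin.suc) (f≢0 ∘ Fin.suc))

    product-const : ∀ {n} (f : Fin n → Carrier) {c} → (∀ i → f i ≡ c) → product f ≡ c ^ n
    product-const {zero}  f f≡c = refl
    product-const {suc n} f f≡c = cong₂ _*_ (f≡c Fin.zero) (product-const (f ∘ Fin.suc) (f≡c ∘ Fin.suc))

    module Fermat {s : ℕ} (e : Carrier ↔ Fin (suc s)) {c : Carrier} (c≢0 : c ≢ 0#) where
      open Inverse e using (to; from; strictlyInverseʳ)
      open Enumeration e

      scale : Permutation (suc s) (suc s)
      scale with inverse c c≢0
      ... | c⁻¹ , cc⁻¹≡1 = e ↔-∘ (mk↔ₛ′ (c *_) (c⁻¹ *_) (inverse-cancelʳ cc⁻¹≡1) (inverse-cancelˡ cc⁻¹≡1) ↔-∘ ↔-sym e)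

      factor : Fin (suc s) → Carrier
      factor i = ifZero (from i) 1# c

      P : Carrier
      P = product (nonzeroPart ∘ from)

      product-factor : product factor ≡ c ^ s
      product-factor = begin
        product factor                                ≡⟨ product-remove {i = to 0#} factor ⟩
        factor (to 0#) * product (factor ∘ punchIn (to 0#))
          ≡⟨ cong₂ _*_ (trans (cong (λ x → ifZero x 1# c) (strictlyInverseʳ 0#)) (ifZero-0 1# c))
                       (product-const (factor ∘ punchIn (to 0#)) (λ i → ifZero-≢0 1# c (nonzeroElem-≢0 i))) ⟩
        1# * c ^ s                                    ≡⟨ *-identityˡ (c ^ s) ⟩
        c ^ s                                         ∎

      P≡cˢP : P * 1# ≡ P * c ^ s
      P≡cˢP = begin
        P * 1#                                        ≡⟨ *-identityʳ P ⟩
        P                                             ≡⟨ product-permute (nonzeroPart ∘ from) scale ⟩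
        product (nonzeroPart ∘ from ∘ Inverse.to scale)
          ≡⟨ product-cong (λ i → trans (cong nonzeroPart (strictlyInverseʳ _)) (nonzeroPart-* c≢0 (from i))) ⟩
        product (λ i → factor i * nonzeroPart (from i))  ≡⟨ product-distrib factor (nonzeroPart ∘ from) ⟩
        product factor * P                            ≡⟨ cong (_* P) product-factor ⟩
        c ^ s * P                                     ≡⟨ *-comm (c ^ s) P ⟩
        P * c ^ s                                     ∎

      fermat : c ^ s ≡ 1#
      fermat = sym (*-cancelˡ (product-≢0 (nonzeroPart ∘ from) (nonzeroPart-≢0 ∘ from)) P≡cˢP)

  fermat : ∀ {c} → c ≢ 0# → c ^ (size ∸ 1) ≡ 1#
  fermat = fermat′ enum
    where
    fermat′ : ∀ {n} → Carrier ↔ Fin n → ∀ {c} → c ≢ 0# → c ^ (n ∸ 1) ≡ 1#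
    fermat′ {zero}  e = ⊥-elim (¬Fin0 (Inverse.to e 0#))
    fermat′ {suc n} e c≢0 = Fermat.fermat e c≢0

  module _ {g : Carrier} (gen : IsGenerator K g) where

    log : ∀ {x} → x ≢ 0# → ℕ
    log {x} x≢0 = proj₁ (proj₂ gen x x≢0)

    ^-log : ∀ {x} (x≢0 : x ≢ 0#) → g ^ log x≢0 ≡ x
    ^-log {x} x≢0 = proj₂ (proj₂ gen x x≢0)

    -- A period r + 1 < |K| - 1 would leave the |K| - 1 nonzero elements only r + 1 possible values.
    period-≮ : ∀ r → g ^ suc r ≡ 1# → ¬ suc r < size ∸ 1
    period-≮ r gʳ⁺¹≡1 = period-≮′ enum
      where
      period-≮′ : ∀ {n} → Carrier ↔ Fin n → ¬ suc r < n ∸ 1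
      period-≮′ {zero}  e _   = ¬Fin0 (Inverse.to e 0#)
      period-≮′ {suc s} e r<s = collision (pigeonhole r<s (λ i → logOf i mod suc r))
        where
        open Enumeration e

        logOf : Fin s → ℕ
        logOf i = log (nonzeroElem-≢0 i)

        collision : (∃₂ λ i j → i Fin.< j × logOf i mod suc r ≡ logOf j mod suc r) → ⊥
        collision (i , j , i<j , residues≡) = <⇒≢ i<j (nonzeroElem-injective (begin
          nonzeroElem i   ≡⟨ ^-log (nonzeroElem-≢0 i) ⟨
          g ^ logOf i     ≡⟨ ^-mod gʳ⁺¹≡1 (logOf i) (logOf j) residues≡ ⟩
          g ^ logOf j     ≡⟨ ^-log (nonzeroElem-≢0 j) ⟩
          nonzeroElem j   ∎))

    generator-order : ∀ m → g ^ m ≡ 1# → (size ∸ 1) ∣ m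
    generator-order m gᵐ≡1 with m % (size ∸ 1) in m%q≡
    ... | zero  = m%n≡0⇒n∣m m (size ∸ 1) m%q≡
    ... | suc r = ⊥-elim (period-≮ r gʳ⁺¹≡1 (subst (_< size ∸ 1) m%q≡ (m%n<n m (size ∸ 1))))
      where
      gʳ⁺¹≡1 : g ^ suc r ≡ 1#
      gʳ⁺¹≡1 = begin
        g ^ suc r              ≡⟨ cong (g ^_) m%q≡ ⟨
        g ^ (m % (size ∸ 1))   ≡⟨ ^-% (fermat (proj₁ gen)) m ⟨
        g ^ m                  ≡⟨ gᵐ≡1 ⟩
        1#                     ∎

  cyclotomic-sub-id : ∀ {g k} .{{_ : NonZero k}} {a : Fin k → Carrier} {ψ : Carrier → Carrier} →
                      IsCyclotomicMap K g k a ψ → IsCyclotomicMap K g k (λ i → a i - 1#) (λ x → ψ x - x)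
  cyclotomic-sub-id {a = a} {ψ} (ψ0≡0 , ψ-class) =
    trans (cong (_- 0#) ψ0≡0) (-‿inverseʳ 0#) , λ i x x∈Cᵢ → begin
      ψ x - x               ≡⟨ cong (_- x) (ψ-class i x x∈Cᵢ) ⟩
      a i * x + - x         ≡⟨ cong (λ y → a i * x + - y) (*-identityˡ x) ⟨
      a i * x + - (1# * x)  ≡⟨ cong (a i * x +_) (-‿distribˡ-* 1# x) ⟩
      a i * x + (- 1#) * x  ≡⟨ distribʳ x (a i) (- 1#) ⟨
      (a i - 1#) * x        ∎

  cyclotomic-multipliers-agree : ∀ {g} → g ≢ 0# →
                                 ∀ {k ℓ} {a : Fin (suc k) → Carrier} {b : Fin (suc ℓ) → Carrier} {θ} →
                                 (ℓ<k : suc ℓ < suc k) → IsCyclotomicMap K g (suc k) a θ →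
                                 IsCyclotomicMap K g (suc ℓ) b θ → a Fin.zero ≡ a (fromℕ< ℓ<k)
  cyclotomic-multipliers-agree {g} g≢0 {k} {ℓ} {a} {b} {θ} ℓ<k (_ , θ-k) (_ , θ-ℓ) = begin
    a Fin.zero      ≡⟨ *-cancelʳ (0≢1 ∘ sym) (trans (sym (θ-k Fin.zero 1# 1∈C₀)) (θ-ℓ Fin.zero 1# 1∈C₀)) ⟩
    b Fin.zero      ≡⟨ *-cancelʳ (^-≢0 g≢0 (suc ℓ))
                         (trans (sym (θ-ℓ Fin.zero gˡ gˡ∈C₀)) (θ-k (fromℕ< ℓ<k) gˡ gˡ∈Cₗ)) ⟩
    a (fromℕ< ℓ<k)  ∎
    where
    gˡ = g ^ suc ℓ
    1∈C₀ : ∀ {n} → InClass K g (suc n) Fin.zero 1#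
    1∈C₀ = 0 , refl , refl
    gˡ∈C₀ : InClass K g (suc ℓ) Fin.zero gˡ
    gˡ∈C₀ = suc ℓ , n%n≡0 (suc ℓ) , refl
    gˡ∈Cₗ : InClass K g (suc k) (fromℕ< ℓ<k) gˡ
    gˡ∈Cₗ = suc ℓ , trans (m<n⇒m%n≡m ℓ<k) (sym (toℕ-fromℕ< ℓ<k)) , refl

  firstThenRest-leastIndex : ∀ {g} → g ≢ 0# → ∀ {k} .{{_ : NonZero k}} {α β θ} → α ≢ β →
                             IsCyclotomicMap K g k (firstThenRest k α β) θ →
                             ∀ ℓ .{{_ : NonZero ℓ}} → ℓ < k → ¬ InC K g ℓ θ
  firstThenRest-leastIndex g≢0 {suc k} α≢β θ-k (suc ℓ) ℓ<k (_ , _ , θ-ℓ) =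
    α≢β (cyclotomic-multipliers-agree g≢0 ℓ<k θ-k θ-ℓ)

module ExtensionProperties {F E : FiniteField} (ext : Extension F E) where
  private
    module F = FiniteField F
    module F′ = FiniteFieldProperties F
    module FR = IsCommutativeRing F.isCommutativeRing
    module FP = RingProperties (CommutativeRing.ring F′.commutativeRing)
  open FiniteField E
  open FiniteFieldProperties E
  open IsCommutativeRing isCommutativeRing using (*-comm; +-identityʳ; zeroˡ)
  open RingProperties (CommutativeRing.ring commutativeRing) using (+-cancelˡ; +-inverseʳ-unique; x≈y⇒x∙y⁻¹≈ε)
  open Extension ext
  open ≡-Reasoning

  ι-0 : ι F.0# ≡ 0#
  ι-0 = +-cancelˡ (ι F.0#) (ι F.0#) 0# (begin
    ι F.0# + ι F.0#    ≡⟨ ι-+ F.0# F.0# ⟨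
    ι (F.0# F.+ F.0#)  ≡⟨ cong ι (FR.+-identityʳ F.0#) ⟩
    ι F.0#             ≡⟨ +-identityʳ (ι F.0#) ⟨
    ι F.0# + 0#        ∎)

  ι-neg : ∀ x → ι (F.- x) ≡ - ι x
  ι-neg x = +-inverseʳ-unique (ι x) (ι (F.- x)) (begin
    ι x + ι (F.- x)    ≡⟨ ι-+ x (F.- x) ⟨
    ι (x F.- x)        ≡⟨ cong ι (FR.-‿inverseʳ x) ⟩
    ι F.0#             ≡⟨ ι-0 ⟩
    0#                 ∎)

  ι-sub : ∀ x y → ι (x F.- y) ≡ ι x - ι y
  ι-sub x y = trans (ι-+ x (F.- y)) (cong (ι x +_) (ι-neg y))

  ι-^ : ∀ c n → ι (c F.^ n) ≡ ι c ^ n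
  ι-^ c zero    = ι-1
  ι-^ c (suc n) = trans (ι-* c (c F.^ n)) (cong (ι c *_) (ι-^ c n))

  ι-≢0 : ∀ {c} → c ≢ F.0# → ι c ≢ 0#
  ι-≢0 {c} c≢0 ιc≡0 with F.inverse c c≢0
  ... | c⁻¹ , cc⁻¹≡1 = 0≢1 (begin
    0#             ≡⟨ zeroˡ (ι c⁻¹) ⟨
    0# * ι c⁻¹     ≡⟨ cong (_* ι c⁻¹) ιc≡0 ⟨
    ι c * ι c⁻¹    ≡⟨ ι-* c c⁻¹ ⟨
    ι (c F.* c⁻¹)  ≡⟨ cong ι cc⁻¹≡1 ⟩
    ι F.1#         ≡⟨ ι-1 ⟩
    1#             ∎)

  ι-≢ : ∀ {x y} → x ≢ y → ι x ≢ ι y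
  ι-≢ {x} {y} x≢y ιx≡ιy = ι-≢0 (x≢y ∘ FP.x∙y⁻¹≈ε⇒x≈y x y) (trans (ι-sub x y) (x≈y⇒x∙y⁻¹≈ε ιx≡ιy))

  IsEmbeddedUnit : Carrier → Set
  IsEmbeddedUnit u = ∃ λ c → c ≢ F.0# × ι c ≡ u

  embeddedUnit-≢0 : ∀ {u} → IsEmbeddedUnit u → u ≢ 0#
  embeddedUnit-≢0 (c , c≢0 , refl) = ι-≢0 c≢0

  embeddedUnit-inverse : ∀ {u} → IsEmbeddedUnit u → ∃ λ u⁻¹ → IsEmbeddedUnit u⁻¹ × u * u⁻¹ ≡ 1#
  embeddedUnit-inverse (c , c≢0 , refl) with F.inverse c c≢0
  ... | c⁻¹ , cc⁻¹≡1 = ι c⁻¹ , (c⁻¹ , F′.inverse-≢0 cc⁻¹≡1 , refl) ,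
                       trans (sym (ι-* c c⁻¹)) (trans (cong ι cc⁻¹≡1) ι-1)

  embeddedUnit-sub-1 : ∀ {c} → c ≢ F.1# → IsEmbeddedUnit (ι c - 1#)
  embeddedUnit-sub-1 {c} c≢1 =
    c F.- F.1# , c≢1 ∘ FP.x∙y⁻¹≈ε⇒x≈y c F.1# , trans (ι-sub c F.1#) (cong (λ y → ι c - y) ι-1)

  module _ {g : Carrier} (gen : IsGenerator E g) {k : ℕ} .{{_ : NonZero k}}
           (k-index : k ℕ.* (F.size ∸ 1) ≡ size ∸ 1) where

    embeddedUnit-power : ∀ {u} → IsEmbeddedUnit u → ∃ λ t → g ^ (t ℕ.* k) ≡ u
    embeddedUnit-power (c , c≢0 , refl) = quotient , trans (cong (g ^_) (sym equality)) (^-log gen ιc≢0)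
      where
      ιc≢0 = ι-≢0 c≢0
      j = log gen ιc≢0
      g^[j*|F*|]≡1 : g ^ (j ℕ.* (F.size ∸ 1)) ≡ 1#
      g^[j*|F*|]≡1 = begin
        g ^ (j ℕ.* (F.size ∸ 1))  ≡⟨ ^-* g j (F.size ∸ 1) ⟩
        (g ^ j) ^ (F.size ∸ 1)    ≡⟨ cong (_^ (F.size ∸ 1)) (^-log gen ιc≢0) ⟩
        ι c ^ (F.size ∸ 1)        ≡⟨ ι-^ c (F.size ∸ 1) ⟨
        ι (c F.^ (F.size ∸ 1))    ≡⟨ cong ι (F′.fermat c≢0) ⟩
        ι F.1#                    ≡⟨ ι-1 ⟩
        1#                        ∎
      k∣j : k ∣ j
      k∣j = *-cancelʳ-∣ (F.size ∸ 1)
              (subst (_∣ j ℕ.* (F.size ∸ 1)) (sym k-index) (generator-order gen _ g^[j*|F*|]≡1))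
      open _∣_ k∣j

    inClass-* : ∀ {u i x} → IsEmbeddedUnit u → InClass E g k i x → InClass E g k i (u * x)
    inClass-* {u} u∈ι (j , j%k≡i , refl) with embeddedUnit-power u∈ι
    ... | t , refl = j ℕ.+ t ℕ.* k , trans ([m+kn]%n≡m%n j t k) j%k≡i , (begin
      g ^ (j ℕ.+ t ℕ.* k)      ≡⟨ ^-+ g j (t ℕ.* k) ⟩
      g ^ j * g ^ (t ℕ.* k)    ≡⟨ *-comm (g ^ j) (g ^ (t ℕ.* k)) ⟩
      g ^ (t ℕ.* k) * g ^ j    ∎)

    inSomeClass : ∀ {x} → x ≢ 0# → ∃ λ i → InClass E g k i x
    inSomeClass x≢0 = log gen x≢0 mod k , log gen x≢0 , sym (toℕ-fromℕ< (m%n<n _ k)) , ^-log gen x≢0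

    cyclotomic-bijective : ∀ {a : Fin k → Carrier} {ψ : Carrier → Carrier} → (∀ i → IsEmbeddedUnit (a i)) →
                           IsCyclotomicMap E g k a ψ → Bijective _≡_ _≡_ ψ
    cyclotomic-bijective {a} {ψ} a∈ι (ψ0≡0 , ψ-class) =
      injective , strictlySurjective⇒surjective strictlySurjective
      where
      ψ-≢0 : ∀ {x} → x ≢ 0# → ψ x ≢ 0#
      ψ-≢0 {x} x≢0 ψx≡0 with inSomeClass x≢0
      ... | i , x∈Cᵢ = *-≢0 (embeddedUnit-≢0 (a∈ι i)) x≢0 (trans (sym (ψ-class i x x∈Cᵢ)) ψx≡0)

      injective-≢0 : ∀ {x y} → x ≢ 0# → y ≢ 0# → ψ x ≡ ψ y → x ≡ y
      injective-≢0 {x} {y} x≢0 y≢0 ψx≡ψy with inSomeClass x≢0 | inSomeClass y≢0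
      ... | i , x∈Cᵢ | j , y∈Cⱼ with embeddedUnit-inverse (a∈ι i)
      ... | aᵢ⁻¹ , aᵢ⁻¹∈ι , aᵢaᵢ⁻¹≡1 = *-cancelˡ (embeddedUnit-≢0 (a∈ι j)) (begin
        a j * x  ≡⟨ ψ-class j x x∈Cⱼ ⟨
        ψ x      ≡⟨ ψx≡ψy ⟩
        ψ y      ≡⟨ ψ-class j y y∈Cⱼ ⟩
        a j * y  ∎)
        where
        x≡aᵢ⁻¹aⱼy : aᵢ⁻¹ * (a j * y) ≡ x
        x≡aᵢ⁻¹aⱼy = begin
          aᵢ⁻¹ * (a j * y)  ≡⟨ cong (aᵢ⁻¹ *_) (trans (sym (ψ-class j y y∈Cⱼ)) (trans (sym ψx≡ψy) (ψ-class i x x∈Cᵢ))) ⟩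
          aᵢ⁻¹ * (a i * x)  ≡⟨ inverse-cancelˡ aᵢaᵢ⁻¹≡1 x ⟩
          x                 ∎
        x∈Cⱼ : InClass E g k j x
        x∈Cⱼ = subst (InClass E g k j) x≡aᵢ⁻¹aⱼy (inClass-* aᵢ⁻¹∈ι (inClass-* (a∈ι j) y∈Cⱼ))

      injective : Injective _≡_ _≡_ ψ
      injective {x} {y} ψx≡ψy with x ≟ 0# | y ≟ 0#
      ... | yes refl | yes refl = refl
      ... | yes refl | no y≢0   = ⊥-elim (ψ-≢0 y≢0 (trans (sym ψx≡ψy) ψ0≡0))
      ... | no x≢0   | yes refl = ⊥-elim (ψ-≢0 x≢0 (trans ψx≡ψy ψ0≡0))
      ... | no x≢0   | no y≢0   = injective-≢0 x≢0 y≢0 ψx≡ψy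

      strictlySurjective : ∀ y → ∃ λ x → ψ x ≡ y
      strictlySurjective y with y ≟ 0#
      ... | yes refl = 0# , ψ0≡0
      ... | no y≢0 with inSomeClass y≢0
      ... | i , y∈Cᵢ with embeddedUnit-inverse (a∈ι i)
      ... | aᵢ⁻¹ , aᵢ⁻¹∈ι , aᵢaᵢ⁻¹≡1 =
        aᵢ⁻¹ * y , trans (ψ-class i _ (inClass-* aᵢ⁻¹∈ι y∈Cᵢ)) (inverse-cancelʳ aᵢaᵢ⁻¹≡1 y)

firstThenRest-all : ∀ {A : Set} {P : A → Set} k {b₁ b₂ : A} → P b₁ → P b₂ → ∀ i → P (firstThenRest k b₁ b₂ i)
firstThenRest-all k p₁ p₂ Fin.zero    = p₁
firstThenRest-all k p₁ p₂ (Fin.suc _) = p₂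

open import Data.Nat using (_*_)

lemma2p7 : (F E : FiniteField) (ext : Extension F E) →
    4 ≤ FiniteField.size F →
    (a₁ a₂ : FiniteField.Carrier F) →
    a₁ ≢ FiniteField.0# F → a₁ ≢ FiniteField.1# F →
    a₂ ≢ FiniteField.0# F → a₂ ≢ FiniteField.1# F →
    a₁ ≢ a₂ →
    (k : ℕ) .{{_ : NonZero k}} →
    k * (FiniteField.size F ∸ 1) ≡ FiniteField.size E ∸ 1 →
    (g : FiniteField.Carrier E) → IsGenerator E g →
    (θ : FiniteField.Carrier E → FiniteField.Carrier E) →
    IsCyclotomicMap E g k
      (firstThenRest k (Extension.ι ext a₁) (Extension.ι ext a₂)) θ →
    InD E g k θ
lemma2p7 F E ext _ a₁ a₂ a₁≢0 a₁≢1 a₂≢0 a₂≢1 a₁≢a₂ k k-index g gen θ θ-cyclotomic =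
  (orthomorphism , _ , θ-cyclotomic) ,
  λ ℓ ℓ<k _ → E′.firstThenRest-leastIndex (proj₁ gen) (ι-≢ a₁≢a₂) θ-cyclotomic ℓ ℓ<k
  where
  module E = FiniteField E
  module E′ = FiniteFieldProperties E
  open Extension ext using (ι)
  open ExtensionProperties ext

  orthomorphism : IsOrthomorphism E θ
  orthomorphism =
    cyclotomic-bijective gen k-index
      (firstThenRest-all {P = IsEmbeddedUnit} k (a₁ , a₁≢0 , refl) (a₂ , a₂≢0 , refl)) θ-cyclotomic ,
    cyclotomic-bijective gen k-index
      (firstThenRest-all {P = λ x → IsEmbeddedUnit (x E.- E.1#)} k (embeddedUnit-sub-1 a₁≢1) (embeddedUnit-sub-1 a₂≢1))
      (E′.cyclotomic-sub-id θ-cyclotomic)
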